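{- Let $G$ be a finite group with no maximal involutions, and let $\Gamma_G$ be its power graph. (i) If $G$ is cyclic, then $\mathrm{rc}(\Gamma_G)=1$ if $|G|$ is a prime power, and $\mathrm{rc}(\Gamma_G)=2$ otherwise. (ii) If $G$ is noncyclic, then $\mathrm{rc}(\Gamma_G)\in\{2,3\}$.
   Context: For a finite group $G$ with identity $e$, the power graph $\Gamma_G$ is the undirected graph with vertex set $G$ in which two distinct elements are adjacent if one is a power of the other. An involution is an element of order $2$. An involution $x$ is maximal if the only cyclic subgroup of $G$ containing $x$ is $\langle x\rangle$. For a connected graph $\Gamma$, an edge coloring $\zeta:E(\Gamma)\to\{1,\dots,k\}$ (adjacent edges may receive the same color) is a rainbow $k$-coloring if every pair of vertices is joined by a path whose edges have pairwise distinct colors; the rainbow connection number $\mathrm{rc}(\Gamma)$ is the minimum $k$ for which a rainbow $k$-coloring exists. -}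

module Defs where

open import Data.Nat using (ℕ; zero; suc; _≤_; _^_)
open import Data.Nat.Primality using (Prime)
open import Data.Fin using (Fin)
open import Data.List using (List; []; _∷_)
open import Data.List.Relation.Unary.Unique.Propositional using (Unique)
open import Data.Product using (Σ; ∃; _×_; _,_)
open import Data.Sum using (_⊎_)
open import Relation.Nullary using (¬_)
open import Relation.Binary.PropositionalEquality using (_≡_; _≢_)
open import Algebra.Structures using (IsGroup)

-- A finite group of order n: carrier Fin n (every finite group is
-- isomorphic to one of this form), with propositional equality.
record FinGroup : Set where
  field
    n       : ℕ
    _·_     : Fin n → Fin n → Fin n
    e       : Fin n
    inv     : Fin n → Fin n
    isGroup : IsGroup _≡_ _·_ e inv

module _ (G : FinGroup) where
  open FinGroup G

  pow : Fin n → ℕ → Fin n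
  pow x zero    = e
  pow x (suc k) = x · pow x k

  -- y is a power of x  (equivalently y ∈ ⟨x⟩, since G is finite)
  IsPowerOf : Fin n → Fin n → Set
  IsPowerOf y x = ∃ λ k → y ≡ pow x k

  Adj : Fin n → Fin n → Set
  Adj x y = x ≢ y × (IsPowerOf x y ⊎ IsPowerOf y x)

  IsCyclic : Set
  IsCyclic = ∃ λ g → ∀ x → IsPowerOf x g

  Involution : Fin n → Set
  Involution x = x ≢ e × (x · x ≡ e)

  -- the only cyclic subgroup containing x is ⟨x⟩:
  -- whenever x ∈ ⟨y⟩ we have ⟨y⟩ = ⟨x⟩, i.e. y ∈ ⟨x⟩
  MaximalInvolution : Fin n → Set
  MaximalInvolution x = Involution x × (∀ y → IsPowerOf x y → IsPowerOf y x)

  NoMaximalInvolutions : Set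
  NoMaximalInvolutions = ∀ x → ¬ MaximalInvolution x

  -- An edge colouring with k colours: a symmetric colour assignment on
  -- pairs of vertices (only its values on edges matter).
  record EdgeColouring (k : ℕ) : Set where
    field
      col : Fin n → Fin n → Fin k
      sym : ∀ x y → col x y ≡ col y x

  data Path {k : ℕ} (c : Fin n → Fin n → Fin k) : Fin n → Fin n → List (Fin k) → Set where
    here : ∀ x → Path c x x []
    step : ∀ {x y z cs} → Adj x y → Path c y z cs → Path c x z (c x y ∷ cs)

  RainbowColouring : (k : ℕ) → EdgeColouring k → Set
  RainbowColouring k ζ = ∀ x y → ∃ λ cs → Path (EdgeColouring.col ζ) x y cs × Unique cs

  HasRainbowColouring : ℕ → Set
  HasRainbowColouring k = Σ (EdgeColouring k) (RainbowColouring k)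

  RcIs : ℕ → Set
  RcIs r = 1 ≤ r × HasRainbowColouring r
         × (∀ k → 1 ≤ k → HasRainbowColouring k → r ≤ k)

IsPrimePower : ℕ → Set
IsPrimePower m = ∃ λ p → ∃ λ a → Prime p × m ≡ p ^ a

module Submission where

open import Defs
open import Data.Product using (_×_; _,_)
open import Data.Sum using (_⊎_)
open import Relation.Nullary using (¬_)
open import Data.Fin using (Fin)

-- A rainbow 1-colouring exists iff any two elements are comparable (one is a power of the
-- other); this forces G to be cyclic, and then G ≅ ℤ/n with n a prime power, since for
-- n = p^a·M with p ∤ M ≠ 1 the residues p^a and M are incomparable.
--
-- Every cyclic group has a rainbow 2-colouring, built on ℤ/n by induction on n. Split
-- n = P·M with P a power of an odd prime and gcd(P, M) = 1; by the Chinese remainder theorem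
-- residues are pairs, edges inside a fibre over ℤ/P reuse the colouring of ℤ/M, and two
-- incomparable residues in different fibres are joined through (x mod P, 0) or through
-- (u, 1) for a unit u ∈ {1, -1}.
--
-- A noncyclic group needs at least 2 colours. Without maximal involutions 3 colours suffice:
-- edges at e are coloured by whether the other endpoint z precedes z⁻¹, all other edges get
-- the third colour, and every x ≠ e has a neighbour x′ ≠ e with the other colour at e
-- (x⁻¹, or for an involution x some y with x ∈ ⟨y⟩ ≠ ⟨x⟩, or y⁻¹). Whether 2 colours suffice
-- is decided by exhaustive search, as rainbow 2-colourings only use paths of length ≤ 2.

module MultiplesMod where

  open import Data.Nat
  open import Data.Nat.Properties
  open import Data.Nat.DivMod
  open import Data.Nat.Divisibility
  open import Data.Nat.GCD
  open import Data.Nat.Coprimality using (Coprime; coprime-Bézout; coprime-divisor)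
    renaming (sym to coprime-sym)
  open import Data.Nat.Primality
  open import Data.Nat.Primality.Factorisation using (factorise)
  open import Data.Nat.Induction using (<-rec)
  open import Data.List using ([]; _∷_)
  open import Data.Nat.ListAction using (product)
  open import Data.List.Relation.Unary.All using (_∷_)
  open import Data.Nat.Tactic.RingSolver using (solve-∀)
  open import Data.Product
  open import Data.Sum
  open import Data.Empty
  open import Relation.Nullary
  open import Function using (_∘_)
  open import Relation.Binary.PropositionalEquality

  -- ℤ/N is represented by the residues 0, …, N - 1, and IsMultipleMod N x y says x ∈ ⟨y⟩.
  IsMultipleMod : (N : ℕ) .{{_ : NonZero N}} → ℕ → ℕ → Set
  IsMultipleMod N x y = ∃ λ k → (k * y) % N ≡ x

  ComparableMod : (N : ℕ) .{{_ : NonZero N}} → ℕ → ℕ → Set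
  ComparableMod N x y = IsMultipleMod N x y ⊎ IsMultipleMod N y x

  isMultipleMod-refl : ∀ N .{{_ : NonZero N}} {x} → x < N → IsMultipleMod N x x
  isMultipleMod-refl N {x} x<N = 1 , trans (cong (_% N) (*-identityˡ x)) (m<n⇒m%n≡m x<N)

  0-isMultipleMod : ∀ N .{{_ : NonZero N}} y → IsMultipleMod N 0 y
  0-isMultipleMod N y = 0 , m*n%n≡0 0 N

  isMultipleMod-of-0 : ∀ N .{{_ : NonZero N}} {x} → IsMultipleMod N x 0 → x ≡ 0
  isMultipleMod-of-0 N (k , k0≡x) = trans (sym k0≡x) (trans (cong (_% N) (*-zeroʳ k)) (m*n%n≡0 0 N))

  isMultipleMod-∣ : ∀ N .{{_ : NonZero N}} {Q} .{{_ : NonZero Q}} → Q ∣ N →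
                    ∀ {x y} → Q ∣ y → IsMultipleMod N x y → Q ∣ x
  isMultipleMod-∣ N {Q} Q∣N {x} {y} Q∣y (k , ky≡x) = m%n≡0⇒n∣m x Q (begin
    x % Q            ≡⟨ cong (_% Q) ky≡x ⟨
    (k * y) % N % Q  ≡⟨ m∣n⇒o%n%m≡o%m Q N (k * y) Q∣N ⟩
    (k * y) % Q      ≡⟨ n∣m⇒m%n≡0 (k * y) Q (∣n⇒∣m*n k Q∣y) ⟩
    0                ∎)
    where open ≡-Reasoning

  %-*-congˡ : ∀ N .{{_ : NonZero N}} {k k′} y → k % N ≡ k′ % N → (k * y) % N ≡ (k′ * y) % N
  %-*-congˡ N {k} {k′} y k≡k′ = begin
    (k * y) % N                ≡⟨ %-distribˡ-* k y N ⟩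
    ((k % N) * (y % N)) % N    ≡⟨ cong (λ t → (t * (y % N)) % N) k≡k′ ⟩
    ((k′ % N) * (y % N)) % N   ≡⟨ %-distribˡ-* k′ y N ⟨
    (k′ * y) % N               ∎
    where open ≡-Reasoning

  *-%-absorbʳ : ∀ N .{{_ : NonZero N}} k y → (k * (y % N)) % N ≡ (k * y) % N
  *-%-absorbʳ N k y = begin
    (k * (y % N)) % N            ≡⟨ %-distribˡ-* k (y % N) N ⟩
    ((k % N) * (y % N % N)) % N  ≡⟨ cong (λ t → ((k % N) * t) % N) (m%n%n≡m%n y N) ⟩
    ((k % N) * (y % N)) % N      ≡⟨ %-distribˡ-* k y N ⟨
    (k * y) % N                  ∎
    where open ≡-Reasoning

  isMultipleMod-of-1 : ∀ N .{{_ : NonZero N}} x → IsMultipleMod N (x % N) (1 % N)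
  isMultipleMod-of-1 N x = x , trans (*-%-absorbʳ N x 1) (cong (_% N) (*-identityʳ x))

  %-≡-offset : ∀ {a b} q₁ q₂ N .{{_ : NonZero N}} → a + q₁ * N ≡ b + q₂ * N → a % N ≡ b % N
  %-≡-offset {a} {b} q₁ q₂ N eq = begin
    a % N            ≡⟨ [m+kn]%n≡m%n a q₁ N ⟨
    (a + q₁ * N) % N ≡⟨ cong (_% N) eq ⟩
    (b + q₂ * N) % N ≡⟨ [m+kn]%n≡m%n b q₂ N ⟩
    b % N            ∎
    where open ≡-Reasoning

  -- k · j ≡ gcd j N (mod N), with multiples of N on both sides so that no subtraction occurs.
  bézout-mod : ∀ N .{{_ : NonZero N}} j → ∃ λ k → ∃₂ λ q₁ q₂ → k * j + q₁ * N ≡ gcd j N + q₂ * N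
  bézout-mod N j with Bézout.identity (gcd-GCD j N)
  ... | Bézout.+- x y d+yN≡xj = x , 0 , y , trans (+-identityʳ (x * j)) (sym d+yN≡xj)
  ... | Bézout.-+ x y d+xj≡yN = x * pred N , y , x * j , (begin
    x * pred N * j + y * N        ≡⟨ cong (x * pred N * j +_) d+xj≡yN ⟨
    x * pred N * j + (d + x * j)  ≡⟨ rearrange x j d (pred N) ⟩
    d + x * j * suc (pred N)      ≡⟨ cong (λ t → d + x * j * t) (suc-pred N) ⟩
    d + x * j * N                 ∎)
    where
    open ≡-Reasoning
    d = gcd j N
    rearrange : ∀ x j d n → x * n * j + (d + x * j) ≡ d + x * j * suc n
    rearrange = solve-∀

  isMultipleMod-of-gcd : ∀ N .{{_ : NonZero N}} {i} j → gcd j N ∣ i → i < N → IsMultipleMod N i j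
  isMultipleMod-of-gcd N {i} j (divides c i≡cd) i<N with bézout-mod N j
  ... | k , q₁ , q₂ , eq = c * k , (begin
    c * k * j % N  ≡⟨ %-≡-offset (c * q₁) (c * q₂) N (scale c k j q₁ q₂ N d eq) ⟩
    c * d % N      ≡⟨ cong (_% N) i≡cd ⟨
    i % N          ≡⟨ m<n⇒m%n≡m i<N ⟩
    i              ∎)
    where
    open ≡-Reasoning
    d = gcd j N
    scale : ∀ c k j q₁ q₂ N d → k * j + q₁ * N ≡ d + q₂ * N → c * k * j + c * q₁ * N ≡ c * d + c * q₂ * N
    scale c k j q₁ q₂ N d eq = begin
      c * k * j + c * q₁ * N      ≡⟨ cong₂ _+_ (*-assoc c k j) (*-assoc c q₁ N) ⟩
      c * (k * j) + c * (q₁ * N)  ≡⟨ *-distribˡ-+ c (k * j) (q₁ * N) ⟨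
      c * (k * j + q₁ * N)        ≡⟨ cong (c *_) eq ⟩
      c * (d + q₂ * N)            ≡⟨ *-distribˡ-+ c d (q₂ * N) ⟩
      c * d + c * (q₂ * N)        ≡⟨ cong (c * d +_) (*-assoc c q₂ N) ⟨
      c * d + c * q₂ * N          ∎

  ∣p^a⇒≡p^ : ∀ {p d} → Prime p → ∀ a → d ∣ p ^ a → ∃ λ s → d ≡ p ^ s
  ∣p^a⇒≡p^ {p} {d} pp zero d∣1 = 0 , ∣1⇒≡1 d∣1
  ∣p^a⇒≡p^ {p} {d} pp (suc a) d∣p^[1+a] with p ∣? d
  ... | yes (divides q d≡qp) with ∣p^a⇒≡p^ pp a (*-cancelˡ-∣ p {{prime⇒nonZero pp}} p*q∣p*p^a)
    where
    p*q∣p*p^a : p * q ∣ p * p ^ a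
    p*q∣p*p^a = subst (_∣ p * p ^ a) (trans d≡qp (*-comm q p)) d∣p^[1+a]
  ...   | s , q≡p^s = suc s , trans d≡qp (trans (cong (_* p) q≡p^s) (*-comm (p ^ s) p))
  ∣p^a⇒≡p^ {p} {d} pp (suc a) d∣p^[1+a] | no p∤d = ∣p^a⇒≡p^ pp a (coprime-divisor d⊥p d∣p^[1+a])
    where
    d⊥p : Coprime d p
    d⊥p (c∣d , c∣p) with prime⇒irreducible pp c∣p
    ... | inj₁ c≡1   = c≡1
    ... | inj₂ refl = ⊥-elim (p∤d c∣d)

  ^-monoʳ-∣ : ∀ p {s t} → s ≤ t → p ^ s ∣ p ^ t
  ^-monoʳ-∣ p {s} {t} s≤t = divides (p ^ (t ∸ s)) (begin
    p ^ t                 ≡⟨ cong (p ^_) (m+[n∸m]≡n s≤t) ⟨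
    p ^ (s + (t ∸ s))     ≡⟨ ^-distribˡ-+-* p s (t ∸ s) ⟩
    p ^ s * p ^ (t ∸ s)   ≡⟨ *-comm (p ^ s) (p ^ (t ∸ s)) ⟩
    p ^ (t ∸ s) * p ^ s   ∎)
    where open ≡-Reasoning

  ∣p^a-total : ∀ {p d₁ d₂} → Prime p → ∀ a → d₁ ∣ p ^ a → d₂ ∣ p ^ a → d₁ ∣ d₂ ⊎ d₂ ∣ d₁
  ∣p^a-total {p} pp a d₁∣ d₂∣ with ∣p^a⇒≡p^ pp a d₁∣ | ∣p^a⇒≡p^ pp a d₂∣
  ... | s , refl | t , refl = Data.Sum.map (^-monoʳ-∣ p) (^-monoʳ-∣ p) (≤-total s t)

  primePower⇒comparableMod : ∀ N .{{_ : NonZero N}} {p} → Prime p → ∀ a → N ≡ p ^ a →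
                             ∀ {i j} → i < N → j < N → ComparableMod N i j
  primePower⇒comparableMod N {p} pp a N≡p^a {i} {j} i<N j<N
    with ∣p^a-total pp a (gcd∣p^a i) (gcd∣p^a j)
    where
    gcd∣p^a : ∀ x → gcd x N ∣ p ^ a
    gcd∣p^a x = subst (gcd x N ∣_) N≡p^a (gcd[m,n]∣n x N)
  ... | inj₁ gi∣gj = inj₂ (isMultipleMod-of-gcd N i (∣-trans gi∣gj (gcd[m,n]∣m j N)) j<N)
  ... | inj₂ gj∣gi = inj₁ (isMultipleMod-of-gcd N j (∣-trans gj∣gi (gcd[m,n]∣m i N)) i<N)

  pred²≡1-mod : ∀ P .{{_ : NonZero P}} → 2 ≤ P → (pred P * pred P) % P ≡ 1
  pred²≡1-mod (suc zero)     (s≤s ())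
  pred²≡1-mod (suc (suc q)) _ = trans (cong (_% suc (suc q)) (square q)) ([m+kn]%n≡m%n 1 q (suc (suc q)))
    where
    square : ∀ q → suc q * suc q ≡ 1 + q * suc (suc q)
    square = solve-∀

  -- The witness is 1, or -1 when b = 1.
  unit-divisor : ∀ P .{{_ : NonZero P}} → 3 ≤ P → ∀ {b} → b < P → b ≢ 0 →
                 ∃ λ a → a < P × a ≢ b × a ≢ 0 × IsMultipleMod P b a
  unit-divisor (suc zero)          (s≤s ())
  unit-divisor (suc (suc zero))    (s≤s (s≤s ()))
  unit-divisor P@(suc (suc (suc _))) _ {b} b<P b≢0 with b ≟ 1
  ... | no b≢1   = 1 , s≤s (s≤s z≤n) , (λ 1≡b → b≢1 (sym 1≡b)) , (λ ())
                     , b , trans (cong (_% P) (*-identityʳ b)) (m<n⇒m%n≡m b<P)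
  ... | yes refl = pred P , ≤-refl , (λ ()) , (λ ()) , pred P , pred²≡1-mod P (s≤s (s≤s z≤n))

  crt-from-bézout : ∀ P m .{{_ : NonZero P}} u v → 1 + u * P ≡ v * suc m → ∀ a b →
                    ∃ λ k → k % P ≡ a % P × k % suc m ≡ b % suc m
  crt-from-bézout P m u v 1+uP≡vM a b =
      k
    , %-≡-offset 0 (a * u + b * u * m) P (begin
        k + 0 * P                                ≡⟨ cong (λ t → a * t + b * (u * P * m) + 0 * P) 1+uP≡vM ⟨
        a * (1 + u * P) + b * (u * P * m) + 0 * P ≡⟨ modP a b u P m ⟩
        a + (a * u + b * u * m) * P              ∎)
    , %-≡-offset (b * v) (a * v + b * u * P) (suc m) (begin
        k + b * v * suc m                        ≡⟨ cong (k +_) (*-assoc b v (suc m)) ⟩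
        k + b * (v * suc m)                      ≡⟨ cong (λ t → k + b * t) 1+uP≡vM ⟨
        k + b * (1 + u * P)                      ≡⟨ modM a b u v P m ⟩
        b + (a * v + b * u * P) * suc m          ∎)
    where
    open ≡-Reasoning
    k = a * (v * suc m) + b * (u * P * m)
    modP : ∀ a b u P m → a * (1 + u * P) + b * (u * P * m) + 0 * P ≡ a + (a * u + b * u * m) * P
    modP = solve-∀
    modM : ∀ a b u v P m → a * (v * suc m) + b * (u * P * m) + b * (1 + u * P) ≡ b + (a * v + b * u * P) * suc m
    modM = solve-∀

  crt-exists : ∀ {P M} .{{_ : NonZero P}} .{{_ : NonZero M}} → Coprime P M → ∀ a b →
               ∃ λ k → k % P ≡ a % P × k % M ≡ b % M
  crt-exists {P} {suc m} P⊥M a b with coprime-Bézout P⊥M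
  ... | Bézout.-+ u v 1+uP≡vM = crt-from-bézout P m u v 1+uP≡vM a b
  crt-exists {suc p} {M@(suc _)} P⊥M a b | Bézout.+- v u 1+uM≡vP
    with crt-from-bézout M p u v 1+uM≡vP b a
  ... | k , kM , kP = k , kP , kM

  %-≡⇒∣∸ : ∀ N .{{_ : NonZero N}} {a b} → a ≤ b → a % N ≡ b % N → N ∣ b ∸ a
  %-≡⇒∣∸ N {a} {b} a≤b a≡b = ∣m+n∣m⇒∣n (divides (b / N) shifted) (n∣m*n (a / N))
    where
    open ≡-Reasoning
    d = b ∸ a
    shifted : a / N * N + d ≡ b / N * N
    shifted = +-cancelˡ-≡ (b % N) _ _ (begin
      b % N + (a / N * N + d)   ≡⟨ +-assoc (b % N) _ d ⟨
      b % N + a / N * N + d     ≡⟨ cong (λ t → t + a / N * N + d) a≡b ⟨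
      a % N + a / N * N + d     ≡⟨ cong (_+ d) (m≡m%n+[m/n]*n a N) ⟨
      a + d                     ≡⟨ m+[n∸m]≡n a≤b ⟩
      b                         ≡⟨ m≡m%n+[m/n]*n b N ⟩
      b % N + b / N * N         ∎)

  crt-unique-≤ : ∀ {P M} .{{_ : NonZero P}} .{{_ : NonZero M}} .{{_ : NonZero (P * M)}} → Coprime P M → ∀ {a b} →
                 a ≤ b → a % P ≡ b % P → a % M ≡ b % M → a % (P * M) ≡ b % (P * M)
  crt-unique-≤ {P} {M} P⊥M {a} {b} a≤b aP≡bP aM≡bM with %-≡⇒∣∸ P a≤b aP≡bP
  ... | divides q b∸a≡qP with coprime-divisor (coprime-sym P⊥M)
                                (subst (M ∣_) (trans b∸a≡qP (*-comm q P)) (%-≡⇒∣∸ M a≤b aM≡bM))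
  ...   | divides r q≡rM = begin
    a % (P * M)                    ≡⟨ [m+kn]%n≡m%n a r (P * M) ⟨
    (a + r * (P * M)) % (P * M)    ≡⟨ cong (λ t → (a + t) % (P * M)) b∸a≡rPM ⟨
    (a + (b ∸ a)) % (P * M)        ≡⟨ cong (_% (P * M)) (m+[n∸m]≡n a≤b) ⟩
    b % (P * M)                    ∎
    where
    open ≡-Reasoning
    b∸a≡rPM : b ∸ a ≡ r * (P * M)
    b∸a≡rPM = trans b∸a≡qP (trans (cong (_* P) q≡rM) (trans (*-assoc r M P) (cong (r *_) (*-comm M P))))

  crt-unique : ∀ {P M} .{{_ : NonZero P}} .{{_ : NonZero M}} .{{_ : NonZero (P * M)}} → Coprime P M → ∀ {a b} →
               a % P ≡ b % P → a % M ≡ b % M → a % (P * M) ≡ b % (P * M)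
  crt-unique P⊥M {a} {b} aP≡bP aM≡bM with ≤-total a b
  ... | inj₁ a≤b = crt-unique-≤ P⊥M a≤b aP≡bP aM≡bM
  ... | inj₂ b≤a = sym (crt-unique-≤ P⊥M b≤a (sym aP≡bP) (sym aM≡bM))

  prime≥2 : ∀ {p} → Prime p → 2 ≤ p
  prime≥2 {p} pp = nonTrivial⇒n>1 p {{prime⇒nonTrivial pp}}

  coprime-^ : ∀ {p} → Prime p → ∀ a {M} → ¬ p ∣ M → Coprime (p ^ a) M
  coprime-^ {p} pp a p∤M (d∣p^a , d∣M) with ∣p^a⇒≡p^ pp a d∣p^a
  ... | zero  , d≡1    = d≡1
  ... | suc s , refl = ⊥-elim (p∤M (∣-trans (divides (p ^ s) (*-comm p (p ^ s))) d∣M))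

  nontrivial-divisor : ∀ {d m} → 2 ≤ d → Coprime m d → ¬ d ∣ m
  nontrivial-divisor 2≤d m⊥d d∣m = <⇒≢ 2≤d (sym (m⊥d (d∣m , ∣-refl)))

  module CoprimeProduct (P M : ℕ) .{{_ : NonZero P}} .{{_ : NonZero M}} (P⊥M : Coprime P M) where

    N : ℕ
    N = P * M

    instance
      nonZero-N : NonZero N
      nonZero-N = m*n≢0 P M

    isMultipleMod-from-components : ∀ {x y} → x < N →
      IsMultipleMod P (x % P) (y % P) → IsMultipleMod M (x % M) (y % M) → IsMultipleMod N x y
    isMultipleMod-from-components {x} {y} x<N (k₁ , k₁yP≡xP) (k₂ , k₂yM≡xM) with crt-exists P⊥M k₁ k₂
    ... | k , k≡k₁ , k≡k₂ = k , (begin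
      (k * y) % N  ≡⟨ crt-unique P⊥M (component P k≡k₁ k₁yP≡xP) (component M k≡k₂ k₂yM≡xM) ⟩
      x % N        ≡⟨ m<n⇒m%n≡m x<N ⟩
      x            ∎)
      where
      open ≡-Reasoning
      component : ∀ Q .{{_ : NonZero Q}} {k k′} → k % Q ≡ k′ % Q →
                  (k′ * (y % Q)) % Q ≡ x % Q → (k * y) % Q ≡ x % Q
      component Q {k} {k′} k≡k′ k′yQ≡xQ =
        trans (%-*-congˡ Q y k≡k′) (trans (sym (*-%-absorbʳ Q k′ y)) k′yQ≡xQ)

    crt-element : ∀ {a t} → a < P → t < M → ∃ λ w → w < N × w % P ≡ a × w % M ≡ t
    crt-element {a} {t} a<P t<M with crt-exists P⊥M a t
    ... | k , k≡a , k≡t = k % N , m%n<n k N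
                        , trans (m∣n⇒o%n%m≡o%m P N k (m∣m*n M)) (trans k≡a (m<n⇒m%n≡m a<P))
                        , trans (m∣n⇒o%n%m≡o%m M N k (n∣m*n P)) (trans k≡t (m<n⇒m%n≡m t<M))

    incomparable-factors : 2 ≤ P → 2 ≤ M → ¬ ComparableMod N P M
    incomparable-factors 2≤P 2≤M (inj₁ P∈⟨M⟩) = nontrivial-divisor 2≤M P⊥M (isMultipleMod-∣ N (n∣m*n P) ∣-refl P∈⟨M⟩)
    incomparable-factors 2≤P 2≤M (inj₂ M∈⟨P⟩) =
      nontrivial-divisor 2≤P (coprime-sym P⊥M) (isMultipleMod-∣ N (m∣m*n M) ∣-refl M∈⟨P⟩)

  p≤p^[1+a] : ∀ {p} → Prime p → ∀ a → p ≤ p ^ suc a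
  p≤p^[1+a] {p} pp a = m≤m*n p (p ^ a) {{m^n≢0 p a {{prime⇒nonZero pp}}}}

  factor-out : ∀ {p} → Prime p → ∀ N .{{_ : NonZero N}} → ∃₂ λ a M → N ≡ p ^ a * M × ¬ p ∣ M
  factor-out {p} pp = <-rec Factored induction-step
    where
    Factored : ℕ → Set
    Factored N = .{{_ : NonZero N}} → ∃₂ λ a M → N ≡ p ^ a * M × ¬ p ∣ M
    induction-step : ∀ N → (∀ {q} → q < N → Factored q) → Factored N
    induction-step N rec with p ∣? N
    ... | no p∤N = 0 , N , sym (+-identityʳ N) , p∤N
    ... | yes (divides q N≡qp) with rec q<N
      where
      instance
        nonZero-q : NonZero q
        nonZero-q = ≢-nonZero λ { refl → ≢-nonZero⁻¹ N N≡qp }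
      q<N : q < N
      q<N = subst₂ _<_ (*-identityʳ q) (sym N≡qp) (*-monoʳ-< q (prime≥2 pp))
    ... | a , M , q≡p^aM , p∤M = suc a , M , (begin
      N              ≡⟨ N≡qp ⟩
      q * p          ≡⟨ cong (_* p) q≡p^aM ⟩
      p ^ a * M * p  ≡⟨ rearrange (p ^ a) M p ⟩
      p * p ^ a * M  ∎) , p∤M
      where
      open ≡-Reasoning
      rearrange : ∀ x M p → x * M * p ≡ p * x * M
      rearrange = solve-∀

  factor-out-∣ : ∀ {p} → Prime p → ∀ N .{{_ : NonZero N}} → p ∣ N →
                 ∃₂ λ a M → N ≡ p ^ suc a * M × ¬ p ∣ M
  factor-out-∣ {p} pp N p∣N with factor-out pp N
  ... | zero  , M , N≡M , p∤M = ⊥-elim (p∤M (subst (p ∣_) (trans N≡M (*-identityˡ M)) p∣N))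
  ... | suc a , M , N≡p^[1+a]M , p∤M = a , M , N≡p^[1+a]M , p∤M

  prime-divisor : ∀ M → 2 ≤ M → ∃ λ q → Prime q × q ∣ M
  prime-divisor M@(suc _) 2≤M with factorise M
  ... | record { factors = [] ; isFactorisation = M≡1 } = ⊥-elim (<⇒≢ 2≤M (sym M≡1))
  ... | record { factors = q ∷ qs ; isFactorisation = M≡qqs ; factorsPrime = q-prime ∷ _ } =
    q , q-prime , divides (product qs) (trans M≡qqs (*-comm q (product qs)))

  power-of-2⊎odd-prime-divisor : ∀ N .{{_ : NonZero N}} →
                                 (∃ λ a → N ≡ 2 ^ a) ⊎ (∃ λ p → Prime p × p ≢ 2 × p ∣ N)
  power-of-2⊎odd-prime-divisor N with factor-out prime[2] N
  ... | a , M , N≡2^aM , 2∤M with M ≟ 1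
  ...   | yes refl = inj₁ (a , trans N≡2^aM (*-identityʳ (2 ^ a)))
  ...   | no M≢1 with prime-divisor M 2≤M
    where
    M≢0 : M ≢ 0
    M≢0 refl = ≢-nonZero⁻¹ N (trans N≡2^aM (*-zeroʳ (2 ^ a)))
    2≤M : 2 ≤ M
    2≤M = ≤∧≢⇒< (n≢0⇒n>0 M≢0) (M≢1 ∘ sym)
  ...     | q , q-prime , q∣M =
    inj₂ (q , q-prime , (λ { refl → 2∤M q∣M }) , subst (q ∣_) (sym N≡2^aM) (∣n⇒∣m*n (2 ^ a) q∣M))

  ¬primePower⇒incomparable : ∀ N .{{_ : NonZero N}} → ¬ IsPrimePower N →
                             ∃₂ λ x y → x < N × y < N × ¬ ComparableMod N x y
  ¬primePower⇒incomparable N ¬pp with prime-divisor N 2≤N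
    where
    2≤N : 2 ≤ N
    2≤N = ≤∧≢⇒< (>-nonZero⁻¹ N) (λ 1≡N → ¬pp (2 , 0 , prime[2] , sym 1≡N))
  ... | p , p-prime , p∣N with factor-out-∣ p-prime N p∣N
  ...   | a , M , refl , p∤M with M ≟ 1
  ...     | yes refl = ⊥-elim (¬pp (p , suc a , p-prime , *-identityʳ (p ^ suc a)))
  ...     | no M≢1 = P , M , m<m*n P M 2≤M , subst (M <_) (*-comm M P) (m<m*n M P 2≤P)
                   , CoprimeProduct.incomparable-factors P M (coprime-^ p-prime (suc a) p∤M) 2≤P 2≤M
    where
    P = p ^ suc a
    instance
      nonZero-P : NonZero P
      nonZero-P = m*n≢0⇒m≢0 P
      nonZero-M : NonZero M
      nonZero-M = m*n≢0⇒n≢0 P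
    2≤P : 2 ≤ P
    2≤P = ≤-trans (prime≥2 p-prime) (p≤p^[1+a] p-prime a)
    2≤M : 2 ≤ M
    2≤M = ≤∧≢⇒< (>-nonZero⁻¹ M) (M≢1 ∘ sym)

module RainbowColouringMod where

  open import Data.Nat
  open import Data.Nat.Properties
  open import Data.Nat.DivMod
  open import Data.Nat.Coprimality using (Coprime)
  open import Data.Nat.Primality using (prime[2])
  open import Data.Nat.Induction using (<-rec)
  open import Data.Bool using (Bool; true; false; _∧_; if_then_else_)
  open import Data.Bool.Properties using (∧-comm)
  open import Data.Product
  open import Data.Sum
  open import Data.Empty
  open import Function using (_∘_)
  open import Relation.Nullary
  open import Relation.Nullary.Decidable using (dec-true; dec-false)
  open import Relation.Binary.PropositionalEquality
  open MultiplesMod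

  RainbowDetour : (N : ℕ) .{{_ : NonZero N}} → (ℕ → ℕ → Bool) → ℕ → ℕ → Set
  RainbowDetour N colour x y = ∃ λ w → w < N × w ≢ x × w ≢ y × ComparableMod N x w × ComparableMod N w y
                                       × colour x w ≢ colour w y

  -- The colour of edges at 0 is fixed, which the inductive step relies on.
  record RainbowTwoColouringMod (N : ℕ) .{{_ : NonZero N}} : Set where
    field
      colour     : ℕ → ℕ → Bool
      colour-sym : ∀ x y → colour x y ≡ colour y x
      colour-0ˡ  : ∀ y → colour 0 y ≡ false
      detour     : ∀ {x y} → x < N → y < N → ¬ ComparableMod N x y → RainbowDetour N colour x y

  rainbowDetour-sym : ∀ {N} .{{_ : NonZero N}} {colour} → (∀ x y → colour x y ≡ colour y x) →
                      ∀ {x y} → RainbowDetour N colour y x → RainbowDetour N colour x y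
  rainbowDetour-sym {colour = colour} colour-sym {x} {y} (w , w<N , w≢y , w≢x , y~w , w~x , colours≢) =
    w , w<N , w≢x , w≢y , Data.Sum.swap w~x , Data.Sum.swap y~w ,
    λ eq → colours≢ (trans (colour-sym y w) (trans (sym eq) (colour-sym x w)))

  comparableMod⇒rainbowTwoColouringMod : ∀ {N} .{{_ : NonZero N}} →
    (∀ {x y} → x < N → y < N → ComparableMod N x y) → RainbowTwoColouringMod N
  comparableMod⇒rainbowTwoColouringMod total = record
    { colour     = λ _ _ → false
    ; colour-sym = λ _ _ → refl
    ; colour-0ˡ  = λ _ → refl
    ; detour     = λ x<N y<N incomparable → ⊥-elim (incomparable (total x<N y<N))
    }

  isPositive : ℕ → Bool
  isPositive zero    = false
  isPositive (suc _) = true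

  isPositive-≢0 : ∀ {a} → a ≢ 0 → isPositive a ≡ true
  isPositive-≢0 {zero}  a≢0 = ⊥-elim (a≢0 refl)
  isPositive-≢0 {suc _} _   = refl

  module Extend (P M : ℕ) .{{_ : NonZero P}} .{{_ : NonZero M}} (P⊥M : Coprime P M)
                (R : RainbowTwoColouringMod M) (3≤P : 3 ≤ P)
                (total-P : ∀ {a b} → a < P → b < P → ComparableMod P a b) where

    open CoprimeProduct P M P⊥M
    open RainbowTwoColouringMod R
      renaming (colour to colourM; colour-sym to colourM-sym; colour-0ˡ to colourM-0ˡ; detour to detourM)

    colour : ℕ → ℕ → Bool
    colour x y = if does (x % P ≟ y % P) then colourM (x % M) (y % M) else isPositive (x % P) ∧ isPositive (y % P)

    colour-fibre : ∀ {x y} → x % P ≡ y % P → colour x y ≡ colourM (x % M) (y % M)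
    colour-fibre {x} {y} eq = cong (λ b → if b then colourM (x % M) (y % M) else isPositive (x % P) ∧ isPositive (y % P))
                                   (dec-true (x % P ≟ y % P) eq)

    colour-across : ∀ {x y} → x % P ≢ y % P → colour x y ≡ isPositive (x % P) ∧ isPositive (y % P)
    colour-across {x} {y} neq = cong (λ b → if b then colourM (x % M) (y % M) else isPositive (x % P) ∧ isPositive (y % P))
                                    (dec-false (x % P ≟ y % P) neq)

    colour-sym : ∀ x y → colour x y ≡ colour y x
    colour-sym x y with x % P ≟ y % P
    ... | yes eq = begin
      colour x y               ≡⟨ colour-fibre eq ⟩
      colourM (x % M) (y % M)  ≡⟨ colourM-sym (x % M) (y % M) ⟩
      colourM (y % M) (x % M)  ≡⟨ colour-fibre (sym eq) ⟨
      colour y x               ∎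
      where open ≡-Reasoning
    ... | no neq = begin
      colour x y                              ≡⟨ colour-across neq ⟩
      isPositive (x % P) ∧ isPositive (y % P) ≡⟨ ∧-comm (isPositive (x % P)) _ ⟩
      isPositive (y % P) ∧ isPositive (x % P) ≡⟨ colour-across (λ eq → neq (sym eq)) ⟨
      colour y x                              ∎
      where open ≡-Reasoning

    colour-0ˡ : ∀ y → colour 0 y ≡ false
    colour-0ˡ y with 0 % P ≟ y % P
    ... | yes eq = trans (colour-fibre eq)
                         (subst (λ z → colourM z (y % M) ≡ false) (sym (m*n%n≡0 0 M)) (colourM-0ˡ (y % M)))
    ... | no neq = trans (colour-across neq) (cong (λ z → isPositive z ∧ isPositive (y % P)) (m*n%n≡0 0 P))

    isMultipleMod-in-fibre : ∀ {x y} → x % P ≡ y % P → IsMultipleMod P (x % P) (y % P)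
    isMultipleMod-in-fibre {x} eq = subst (IsMultipleMod P (x % P)) eq (isMultipleMod-refl P (m%n<n x P))

    comparable-in-fibre : ∀ {x y} → x < N → y < N → x % P ≡ y % P →
                          ComparableMod M (x % M) (y % M) → ComparableMod N x y
    comparable-in-fibre x<N y<N eq (inj₁ x∣y) = inj₁ (isMultipleMod-from-components x<N (isMultipleMod-in-fibre eq) x∣y)
    comparable-in-fibre x<N y<N eq (inj₂ y∣x) =
      inj₂ (isMultipleMod-from-components y<N (isMultipleMod-in-fibre (sym eq)) y∣x)

    colours-differ : ∀ {x w y} → colour x w ≡ false → colour w y ≡ true → colour x w ≢ colour w y
    colours-differ xw≡false wy≡true eq with trans (sym xw≡false) (trans eq wy≡true)
    ... | ()

    detour-in-fibre : ∀ {x y} → x < N → y < N → ¬ ComparableMod N x y → x % P ≡ y % P → RainbowDetour N colour x y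
    detour-in-fibre {x} {y} x<N y<N incomparable xP≡yP
      with detourM (m%n<n x M) (m%n<n y M) (λ c → incomparable (comparable-in-fibre x<N y<N xP≡yP c))
    ... | t , t<M , t≢xM , t≢yM , x~t , t~y , colours≢ with crt-element (m%n<n x P) t<M
    ...   | w , w<N , wP≡xP , wM≡t =
        w , w<N , (λ w≡x → t≢xM (trans (sym wM≡t) (cong (_% M) w≡x)))
          , (λ w≡y → t≢yM (trans (sym wM≡t) (cong (_% M) w≡y)))
          , comparable-in-fibre x<N w<N (sym wP≡xP) (subst (ComparableMod M (x % M)) (sym wM≡t) x~t)
          , comparable-in-fibre w<N y<N wP≡yP (subst (λ z → ComparableMod M z (y % M)) (sym wM≡t) t~y)
          , λ eq → colours≢ (begin
              colourM (x % M) t        ≡⟨ cong (colourM (x % M)) wM≡t ⟨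
              colourM (x % M) (w % M)  ≡⟨ colour-fibre (sym wP≡xP) ⟨
              colour x w               ≡⟨ eq ⟩
              colour w y               ≡⟨ colour-fibre wP≡yP ⟩
              colourM (w % M) (y % M)  ≡⟨ cong (λ z → colourM z (y % M)) wM≡t ⟩
              colourM t (y % M)        ∎)
      where
      open ≡-Reasoning
      wP≡yP : w % P ≡ y % P
      wP≡yP = trans wP≡xP xP≡yP

    detour-across-nonzero : ∀ {x y} → x < N → y < N → ¬ IsMultipleMod N x y → x % P ≢ y % P →
                            IsMultipleMod P (x % P) (y % P) → x % P ≢ 0 → RainbowDetour N colour x y
    detour-across-nonzero {x} {y} x<N y<N x∤y xP≢yP xP∣yP xP≢0 with crt-element (m%n<n x P) (>-nonZero⁻¹ M)
    ... | w , w<N , wP≡xP , wM≡0 =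
        w , w<N , (λ w≡x → x∤y (isMultipleMod-from-components x<N xP∣yP (subst (λ z → IsMultipleMod M z (y % M))
                                    (trans (sym wM≡0) (cong (_% M) w≡x)) (0-isMultipleMod M (y % M)))))
          , (λ w≡y → xP≢yP (trans (sym wP≡xP) (cong (_% P) w≡y)))
          , inj₂ (isMultipleMod-from-components w<N (isMultipleMod-in-fibre wP≡xP) wM∣_)
          , inj₁ (isMultipleMod-from-components w<N (subst (λ z → IsMultipleMod P z (y % P)) (sym wP≡xP) xP∣yP) wM∣_)
          , colours-differ
              (trans (colour-fibre (sym wP≡xP)) (trans (cong (colourM (x % M)) wM≡0)
                     (trans (colourM-sym (x % M) 0) (colourM-0ˡ (x % M)))))
              (trans (colour-across (λ eq → xP≢yP (trans (sym wP≡xP) eq)))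
                     (cong₂ _∧_ (trans (cong isPositive wP≡xP) (isPositive-≢0 xP≢0)) (isPositive-≢0 yP≢0)))
      where
      wM∣_ : ∀ {z} → IsMultipleMod M (w % M) (z % M)
      wM∣_ {z} = subst (λ t → IsMultipleMod M t (z % M)) (sym wM≡0) (0-isMultipleMod M (z % M))
      yP≢0 : y % P ≢ 0
      yP≢0 yP≡0 = xP≢0 (isMultipleMod-of-0 P (subst (IsMultipleMod P (x % P)) yP≡0 xP∣yP))

    detour-across-zero : ∀ {x y} → x < N → y < N → x % P ≢ y % P → x % P ≡ 0 → RainbowDetour N colour x y
    detour-across-zero {x} {y} x<N y<N xP≢yP xP≡0
      with unit-divisor P 3≤P (m%n<n y P) (λ yP≡0 → xP≢yP (trans xP≡0 (sym yP≡0)))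
    ... | a , a<P , a≢yP , a≢0 , yP∣a with crt-element a<P (m%n<n 1 M)
    ...   | w , w<N , wP≡a , wM≡1 =
        w , w<N , (λ w≡x → a≢0 (trans (sym wP≡a) (trans (cong (_% P) w≡x) xP≡0)))
          , (λ w≡y → a≢yP (trans (sym wP≡a) (cong (_% P) w≡y)))
          , inj₁ (isMultipleMod-from-components x<N
                    (subst (λ z → IsMultipleMod P z (w % P)) (sym xP≡0) (0-isMultipleMod P (w % P))) (∣wM x))
          , inj₂ (isMultipleMod-from-components y<N (subst (IsMultipleMod P (y % P)) (sym wP≡a) yP∣a) (∣wM y))
          , colours-differ
              (trans (colour-across (λ eq → a≢0 (trans (sym wP≡a) (trans (sym eq) xP≡0))))
                     (cong (λ z → isPositive z ∧ isPositive (w % P)) xP≡0))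
              (trans (colour-across (λ eq → a≢yP (trans (sym wP≡a) eq)))
                     (cong₂ _∧_ (trans (cong isPositive wP≡a) (isPositive-≢0 a≢0))
                                (isPositive-≢0 (λ yP≡0 → xP≢yP (trans xP≡0 (sym yP≡0))))))
      where
      ∣wM : ∀ z → IsMultipleMod M (z % M) (w % M)
      ∣wM z = subst (IsMultipleMod M (z % M)) (sym wM≡1) (isMultipleMod-of-1 M z)

    detour-across : ∀ {x y} → x < N → y < N → ¬ IsMultipleMod N x y → x % P ≢ y % P →
                    IsMultipleMod P (x % P) (y % P) → RainbowDetour N colour x y
    detour-across {x} x<N y<N x∤y xP≢yP xP∣yP with x % P ≟ 0
    ... | yes xP≡0 = detour-across-zero x<N y<N xP≢yP xP≡0
    ... | no xP≢0  = detour-across-nonzero x<N y<N x∤y xP≢yP xP∣yP xP≢0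

    detour : ∀ {x y} → x < N → y < N → ¬ ComparableMod N x y → RainbowDetour N colour x y
    detour {x} {y} x<N y<N incomparable with x % P ≟ y % P
    ... | yes xP≡yP = detour-in-fibre x<N y<N incomparable xP≡yP
    ... | no xP≢yP with total-P (m%n<n x P) (m%n<n y P)
    ...   | inj₁ xP∣yP = detour-across x<N y<N (incomparable ∘ inj₁) xP≢yP xP∣yP
    ...   | inj₂ yP∣xP = rainbowDetour-sym colour-sym
                           (detour-across y<N x<N (incomparable ∘ inj₂) (xP≢yP ∘ sym) yP∣xP)

    extended : RainbowTwoColouringMod N
    extended = record
      { colour = colour ; colour-sym = colour-sym ; colour-0ˡ = colour-0ˡ ; detour = detour }

  rainbowTwoColouringMod : ∀ N .{{_ : NonZero N}} → RainbowTwoColouringMod N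
  rainbowTwoColouringMod = <-rec Colourable induction-step
    where
    Colourable : ℕ → Set
    Colourable N = .{{_ : NonZero N}} → RainbowTwoColouringMod N
    induction-step : ∀ N → (∀ {M} → M < N → Colourable M) → Colourable N
    induction-step N rec with power-of-2⊎odd-prime-divisor N
    ... | inj₁ (a , N≡2^a) = comparableMod⇒rainbowTwoColouringMod (primePower⇒comparableMod N prime[2] a N≡2^a)
    ... | inj₂ (p , p-prime , p≢2 , p∣N) with factor-out-∣ p-prime N p∣N
    ...   | a , M , refl , p∤M =
      Extend.extended P M (coprime-^ p-prime (suc a) p∤M) (rec M<N) 3≤P
        (primePower⇒comparableMod P p-prime (suc a) refl)
      where
      P = p ^ suc a
      instance
        nonZero-P : NonZero P
        nonZero-P = m*n≢0⇒m≢0 P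
        nonZero-M : NonZero M
        nonZero-M = m*n≢0⇒n≢0 P
      3≤P : 3 ≤ P
      3≤P = ≤-trans (≤∧≢⇒< (prime≥2 p-prime) (p≢2 ∘ sym)) (p≤p^[1+a] p-prime a)
      M<N : M < P * M
      M<N = subst (M <_) (*-comm M P) (m<m*n M P (≤-trans (s≤s (s≤s z≤n)) 3≤P))

module GroupPowers (G : FinGroup) where

  open import Level using (0ℓ)
  open import Data.Nat as ℕ using (zero; suc; _+_; _*_; _∸_; _<_; _≤_; NonZero)
  open import Data.Nat.Properties as ℕ using ()
  open import Data.Nat.DivMod using (_%_; _/_; m≡m%n+[m/n]*n; m%n<n)
  open import Data.Fin as Fin using (Fin; toℕ; fromℕ<)
  open import Data.Fin.Properties as Fin using (pigeonhole; any?; toℕ-fromℕ<; toℕ<n)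
  open import Data.Product
  open import Data.Sum
  open import Relation.Nullary
  open import Relation.Binary.PropositionalEquality
  open import Algebra.Bundles using (Group)
  import Algebra.Properties.Group as GroupProperties

  open FinGroup G

  group : Group 0ℓ 0ℓ
  group = record { Carrier = Fin n ; _≈_ = _≡_ ; _∙_ = _·_ ; ε = e ; _⁻¹ = inv ; isGroup = isGroup }

  open Group group public using (identityˡ; identityʳ; inverseˡ; inverseʳ; assoc)
  open GroupProperties group public using (∙-cancelˡ; inverseˡ-unique; inverseʳ-unique; ⁻¹-involutive; ε⁻¹≈ε)

  pow-+ : ∀ x a b → pow G x (a + b) ≡ pow G x a · pow G x b
  pow-+ x zero    b = sym (identityˡ _)
  pow-+ x (suc a) b = trans (cong (x ·_) (pow-+ x a b)) (sym (assoc x _ _))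

  pow-pow : ∀ x a b → pow G (pow G x a) b ≡ pow G x (b * a)
  pow-pow x a zero    = refl
  pow-pow x a (suc b) = trans (cong (pow G x a ·_) (pow-pow x a b)) (sym (pow-+ x a (b * a)))

  pow-e : ∀ k → pow G e k ≡ e
  pow-e zero    = refl
  pow-e (suc k) = trans (identityˡ _) (pow-e k)

  isPowerOf-refl : ∀ x → IsPowerOf G x x
  isPowerOf-refl x = 1 , sym (identityʳ x)

  e-isPowerOf : ∀ x → IsPowerOf G e x
  e-isPowerOf x = 0 , refl

  isPowerOf-trans : ∀ {x y z} → IsPowerOf G x y → IsPowerOf G y z → IsPowerOf G x z
  isPowerOf-trans {z = z} (k , x≡y^k) (j , y≡z^j) =
    k * j , trans x≡y^k (trans (cong (λ t → pow G t k) y≡z^j) (pow-pow z j k))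

  pow-≡⇒pow-∸≡e : ∀ x {a b} → a ≤ b → pow G x a ≡ pow G x b → pow G x (b ∸ a) ≡ e
  pow-≡⇒pow-∸≡e x {a} {b} a≤b x^a≡x^b = sym (∙-cancelˡ (pow G x a) e _ (begin
    pow G x a · e                 ≡⟨ identityʳ _ ⟩
    pow G x a                     ≡⟨ x^a≡x^b ⟩
    pow G x b                     ≡⟨ cong (pow G x) (ℕ.m+[n∸m]≡n a≤b) ⟨
    pow G x (a + (b ∸ a))         ≡⟨ pow-+ x a (b ∸ a) ⟩
    pow G x a · pow G x (b ∸ a)   ∎))
    where open ≡-Reasoning

  order : ∀ x → ∃ λ d → 0 < d × d ≤ n × pow G x d ≡ e
  order x with pigeonhole (ℕ.n<1+n n) (λ (i : Fin (suc n)) → pow G x (toℕ i))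
  ... | i , j , i<j , x^i≡x^j = toℕ j ∸ toℕ i , ℕ.m<n⇒0<n∸m i<j
                              , ℕ.≤-trans (ℕ.m∸n≤m (toℕ j) (toℕ i)) (ℕ.≤-pred (toℕ<n j))
                              , pow-≡⇒pow-∸≡e x (ℕ.<⇒≤ i<j) x^i≡x^j

  pow-% : ∀ x d .{{_ : NonZero d}} → pow G x d ≡ e → ∀ k → pow G x k ≡ pow G x (k % d)
  pow-% x d x^d≡e k = begin
    pow G x k                                 ≡⟨ cong (pow G x) (m≡m%n+[m/n]*n k d) ⟩
    pow G x (k % d + k / d * d)               ≡⟨ pow-+ x (k % d) (k / d * d) ⟩
    pow G x (k % d) · pow G x (k / d * d)     ≡⟨ cong (pow G x (k % d) ·_) (pow-pow x d (k / d)) ⟨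
    pow G x (k % d) · pow G (pow G x d) (k / d) ≡⟨ cong (λ t → pow G x (k % d) · pow G t (k / d)) x^d≡e ⟩
    pow G x (k % d) · pow G e (k / d)         ≡⟨ cong (pow G x (k % d) ·_) (pow-e (k / d)) ⟩
    pow G x (k % d) · e                       ≡⟨ identityʳ _ ⟩
    pow G x (k % d)                           ∎
    where open ≡-Reasoning

  isPowerOf? : ∀ y x → Dec (IsPowerOf G y x)
  isPowerOf? y x with any? (λ (i : Fin n) → y Fin.≟ pow G x (toℕ i))
  ... | yes (i , y≡x^i) = yes (toℕ i , y≡x^i)
  ... | no ∄i with order x
  ...   | d , 0<d , d≤n , x^d≡e = no λ (k , y≡x^k) → ∄i (fromℕ< (k%d<n k) , (begin
    y                                 ≡⟨ y≡x^k ⟩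
    pow G x k                         ≡⟨ pow-% x d x^d≡e k ⟩
    pow G x (k % d)                   ≡⟨ cong (pow G x) (toℕ-fromℕ< (k%d<n k)) ⟨
    pow G x (toℕ (fromℕ< (k%d<n k)))  ∎))
    where
    open ≡-Reasoning
    instance
      nonZero-d : NonZero d
      nonZero-d = ℕ.>-nonZero 0<d
    k%d<n : ∀ k → k % d < n
    k%d<n k = ℕ.<-≤-trans (m%n<n k d) d≤n

  inv-isPowerOf : ∀ x → IsPowerOf G (inv x) x
  inv-isPowerOf x with order x
  ... | suc d , _ , _ , x^[1+d]≡e = d , sym (inverseʳ-unique x (pow G x d) x^[1+d]≡e)

  isPowerOf-inv : ∀ x → IsPowerOf G x (inv x)
  isPowerOf-inv x = subst (λ y → IsPowerOf G y (inv x)) (⁻¹-involutive x) (inv-isPowerOf (inv x))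

  pow-involution : ∀ {y} → y · y ≡ e → ∀ k → pow G y k ≡ e ⊎ pow G y k ≡ y
  pow-involution y²≡e zero = inj₁ refl
  pow-involution {y} y²≡e (suc k) with pow-involution y²≡e k
  ... | inj₁ y^k≡e = inj₂ (trans (cong (y ·_) y^k≡e) (identityʳ y))
  ... | inj₂ y^k≡y = inj₁ (trans (cong (y ·_) y^k≡y) y²≡e)

module PowerGraph where

  open import Data.Nat as ℕ using (zero; suc; z≤n; s≤s; _≤_)
  open import Data.Nat.Properties as ℕ using (≮⇒≥)
  open import Data.Fin as Fin using (Fin; zero; suc)
  open import Data.Fin.Properties as Fin using (any?; all?)
  open import Data.Vec using (Vec; []; _∷_; lookup; tabulate)
  open import Data.Vec.Properties using (lookup∘tabulate)
  open import Data.List using (List; []; _∷_; allFin)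
  open import Data.List.Relation.Unary.All as All using (All; []; _∷_)
  open import Data.List.Relation.Unary.AllPairs using ([]; _∷_)
  open import Data.List.Relation.Unary.Unique.Propositional using (Unique)
  open import Data.List.Membership.Propositional.Properties using (∈-allFin)
  open import Data.Product
  open import Data.Sum
  open import Data.Empty
  open import Function using (_∘_)
  open import Relation.Nullary
  open import Relation.Unary using (Decidable)
  open import Relation.Binary.PropositionalEquality

  Searchable : Set → Set₁
  Searchable A = ∀ {P : A → Set} → Decidable P → Dec (∃ P)

  searchable-Vec : ∀ {A} → Searchable A → ∀ m → Searchable (Vec A m)
  searchable-Vec search-A zero    P? = map′ ([] ,_) (λ { ([] , p) → p }) (P? [])
  searchable-Vec search-A (suc m) P? = map′ (λ (a , as , p) → a ∷ as , p) (λ { (a ∷ as , p) → a , as , p })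
    (search-A λ a → searchable-Vec search-A m λ as → P? (a ∷ as))

  module _ (G : FinGroup) where

    open FinGroup G
    open GroupPowers G

    Comparable : Fin n → Fin n → Set
    Comparable x y = IsPowerOf G x y ⊎ IsPowerOf G y x

    rainbowPath-1⇒comparable : ∀ {c : Fin n → Fin n → Fin 1} {x y cs} → Path G c x y cs → Unique cs → Comparable x y
    rainbowPath-1⇒comparable (here x)              _                       = inj₁ (isPowerOf-refl x)
    rainbowPath-1⇒comparable (step x~y (here _))   _                       = proj₂ x~y
    rainbowPath-1⇒comparable (step _ (step _ _))   ((zero≢zero ∷ _) ∷ _)   = ⊥-elim (zero≢zero (fin1 _ _))
      where
      fin1 : (i j : Fin 1) → i ≡ j
      fin1 zero zero = refl

    rainbow-1⇒comparable : HasRainbowColouring G 1 → ∀ x y → Comparable x y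
    rainbow-1⇒comparable (ζ , rainbow) x y = let (_ , path , unique) = rainbow x y in rainbowPath-1⇒comparable path unique

    comparable⇒cyclic : (∀ x y → Comparable x y) → IsCyclic G
    comparable⇒cyclic comparable = let (g , all) = top (allFin n) in g , λ x → All.lookup all (∈-allFin x)
      where
      top : (xs : List (Fin n)) → ∃ λ g → All (λ x → IsPowerOf G x g) xs
      top []       = e , []
      top (x ∷ xs) with top xs
      ... | g , below-g with comparable x g
      ...   | inj₁ x≤g = g , x≤g ∷ below-g
      ...   | inj₂ g≤x = x , isPowerOf-refl x ∷ All.map (λ y≤g → isPowerOf-trans y≤g g≤x) below-g

    ¬cyclic⇒¬rainbow-1 : ¬ IsCyclic G → ¬ HasRainbowColouring G 1
    ¬cyclic⇒¬rainbow-1 ¬cyclic = ¬cyclic ∘ comparable⇒cyclic ∘ rainbow-1⇒comparable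

    adjacent? : ∀ x y → Dec (Adj G x y)
    adjacent? x y = ¬? (x Fin.≟ y) ×-dec (isPowerOf? x y ⊎-dec isPowerOf? y x)

    ShortRainbowPath : ∀ {k} → (Fin n → Fin n → Fin k) → Fin n → Fin n → Set
    ShortRainbowPath c x y = x ≡ y ⊎ Adj G x y ⊎ ∃ λ w → Adj G x w × Adj G w y × c x w ≢ c w y

    RainbowWithin2 : ∀ {k} → (Fin n → Fin n → Fin k) → Set
    RainbowWithin2 c = ∀ x y → ShortRainbowPath c x y

    rainbowWithin2⇒rainbow : ∀ {k} (ζ : EdgeColouring G k) → RainbowWithin2 (EdgeColouring.col ζ) → RainbowColouring G k ζ
    rainbowWithin2⇒rainbow ζ within2 x y with within2 x y
    ... | inj₁ refl                         = [] , here x , []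
    ... | inj₂ (inj₁ x~y)                   = _ , step x~y (here y) , [] ∷ []
    ... | inj₂ (inj₂ (w , x~w , w~y , c≢)) = _ , step x~w (step w~y (here y)) , (c≢ ∷ []) ∷ [] ∷ []

    rainbowPath-2⇒short : ∀ {c : Fin n → Fin n → Fin 2} {x y cs} → Path G c x y cs → Unique cs → ShortRainbowPath c x y
    rainbowPath-2⇒short (here x)                       _               = inj₁ refl
    rainbowPath-2⇒short (step x~y (here _))            _               = inj₂ (inj₁ x~y)
    rainbowPath-2⇒short (step x~w (step w~y (here _))) ((c≢ ∷ []) ∷ _) = inj₂ (inj₂ (_ , x~w , w~y , c≢))
    rainbowPath-2⇒short (step _ (step _ (step _ _))) ((a≢b ∷ a≢c ∷ _) ∷ (b≢c ∷ _) ∷ _) =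
      ⊥-elim (pairwise-distinct a≢b a≢c b≢c)
      where
      pairwise-distinct : {a b c : Fin 2} → a ≢ b → a ≢ c → b ≢ c → ⊥
      pairwise-distinct {zero}     {zero}                a≢b _   _   = a≢b refl
      pairwise-distinct {suc zero} {suc zero}            a≢b _   _   = a≢b refl
      pairwise-distinct {zero}     {suc zero} {zero}     _   a≢c _   = a≢c refl
      pairwise-distinct {suc zero} {zero}     {suc zero} _   a≢c _   = a≢c refl
      pairwise-distinct {zero}     {suc zero} {suc zero} _   _   b≢c = b≢c refl
      pairwise-distinct {suc zero} {zero}     {zero}     _   _   b≢c = b≢c refl

    rainbowWithin2-resp : ∀ {k} {c c′ : Fin n → Fin n → Fin k} → (∀ x y → c x y ≡ c′ x y) →
                          RainbowWithin2 c → RainbowWithin2 c′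
    rainbowWithin2-resp c≗c′ within2 x y = Data.Sum.map₂ (Data.Sum.map₂ λ (w , x~w , w~y , c≢) →
      w , x~w , w~y , λ eq → c≢ (trans (c≗c′ x w) (trans eq (sym (c≗c′ w y))))) (within2 x y)

    rainbowWithin2? : ∀ {k} (c : Fin n → Fin n → Fin k) → Dec (RainbowWithin2 c)
    rainbowWithin2? c = all? λ x → all? λ y → (x Fin.≟ y) ⊎-dec (adjacent? x y ⊎-dec
      any? (λ w → adjacent? x w ×-dec (adjacent? w y ×-dec ¬? (c x w Fin.≟ c w y))))

    comparable⇒rainbow-1 : (∀ x y → Comparable x y) → HasRainbowColouring G 1
    comparable⇒rainbow-1 comparable = ζ , rainbowWithin2⇒rainbow ζ within2
      where
      ζ : EdgeColouring G 1
      ζ = record { col = λ _ _ → zero ; sym = λ _ _ → refl }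
      within2 : RainbowWithin2 (EdgeColouring.col ζ)
      within2 x y with x Fin.≟ y
      ... | yes x≡y = inj₁ x≡y
      ... | no x≢y  = inj₂ (inj₁ (x≢y , comparable x y))

    -- Colourings are searched as finite tables, so that no function extensionality is needed.
    entry : ∀ {k} → Vec (Vec (Fin k) n) n → Fin n → Fin n → Fin k
    entry table x y = lookup (lookup table x) y

    hasRainbowColouring-2? : Dec (HasRainbowColouring G 2)
    hasRainbowColouring-2? = map′ from-table to-table
      (searchable-Vec (searchable-Vec any? n) n λ table →
        (all? λ x → all? λ y → entry table x y Fin.≟ entry table y x) ×-dec rainbowWithin2? (entry table))
      where
      from-table : (∃ λ table → (∀ x y → entry table x y ≡ entry table y x) × RainbowWithin2 (entry table)) →
                   HasRainbowColouring G 2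
      from-table (table , symmetric , within2) = ζ , rainbowWithin2⇒rainbow ζ within2
        where ζ = record { col = entry table ; sym = symmetric }
      to-table : HasRainbowColouring G 2 →
                 ∃ λ table → (∀ x y → entry table x y ≡ entry table y x) × RainbowWithin2 (entry table)
      to-table (ζ , rainbow) = table , (λ x y → trans (tabulated x y) (trans (sym′ x y) (sym (tabulated y x))))
                             , rainbowWithin2-resp (λ x y → sym (tabulated x y))
                                 (λ x y → let (_ , path , unique) = rainbow x y in rainbowPath-2⇒short path unique)
        where
        open EdgeColouring ζ renaming (sym to sym′)
        table = tabulate λ x → tabulate (col x)
        tabulated : ∀ x y → entry table x y ≡ col x y
        tabulated x y = trans (cong (λ row → lookup row y) (lookup∘tabulate _ x)) (lookup∘tabulate (col x) y)

    before : Fin n → Fin n → Fin 3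
    before a b with a Fin.<? b
    ... | yes _ = zero
    ... | no _  = suc zero

    before-flip : ∀ {a b} → a ≢ b → before a b ≢ before b a
    before-flip {a} {b} a≢b with a Fin.<? b | b Fin.<? a
    ... | yes a<b | yes b<a = λ _ → Fin.<-asym a<b b<a
    ... | yes _   | no _    = λ ()
    ... | no _    | yes _   = λ ()
    ... | no a≮b  | no b≮a  = λ _ → a≢b (Fin.≤-antisym (≮⇒≥ b≮a) (≮⇒≥ a≮b))


    -- Splits every pair {z, z⁻¹} with z ≠ z⁻¹ into the two colours 0 and 1.
    side : Fin n → Fin 3
    side z = before z (inv z)

    side≢2 : ∀ z → side z ≢ suc (suc zero)
    side≢2 z with z Fin.<? inv z
    ... | yes _ = λ ()
    ... | no _  = λ ()

    side-inv : ∀ z → inv z ≢ z → side (inv z) ≢ side z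
    side-inv z z⁻¹≢z = subst (λ t → before (inv z) t ≢ side z) (sym (⁻¹-involutive z)) (before-flip z⁻¹≢z)

    x~e : ∀ {x} → x ≢ e → Adj G x e
    x~e {x} x≢e = x≢e , inj₂ (e-isPowerOf x)

    e~y : ∀ {y} → y ≢ e → Adj G e y
    e~y {y} y≢e = y≢e ∘ sym , inj₁ (e-isPowerOf y)

    nonadjacent⇒≢eˡ : ∀ {x y} → x ≢ y → ¬ Adj G x y → x ≢ e
    nonadjacent⇒≢eˡ x≢y x≁y refl = x≁y (x≢y , inj₁ (e-isPowerOf _))

    nonadjacent⇒≢eʳ : ∀ {x y} → x ≢ y → ¬ Adj G x y → y ≢ e
    nonadjacent⇒≢eʳ x≢y x≁y refl = x≁y (x≢y , inj₂ (e-isPowerOf _))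

    inv≢e : ∀ {x} → x ≢ e → inv x ≢ e
    inv≢e {x} x≢e x⁻¹≡e = x≢e (trans (sym (⁻¹-involutive x)) (trans (cong inv x⁻¹≡e) ε⁻¹≈ε))

    module _ (no-maximal : NoMaximalInvolutions G) where

      neighbour-on-other-side : ∀ {x} → x ≢ e → ∃ λ x′ → Adj G x x′ × x′ ≢ e × side x′ ≢ side x
      neighbour-on-other-side {x} x≢e with inv x Fin.≟ x
      ... | no x⁻¹≢x = inv x , (x⁻¹≢x ∘ sym , inj₂ (inv-isPowerOf x)) , inv≢e x≢e , side-inv x x⁻¹≢x
      ... | yes x⁻¹≡x with any? (λ y → isPowerOf? x y ×-dec ¬? (isPowerOf? y x))
      ...   | no ∄y = ⊥-elim (no-maximal x (involution , λ y x∈⟨y⟩ →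
                        decidable-stable (isPowerOf? y x) (λ y∉⟨x⟩ → ∄y (y , x∈⟨y⟩ , y∉⟨x⟩))))
        where
        involution : Involution G x
        involution = x≢e , trans (cong (x ·_) (sym x⁻¹≡x)) (inverseʳ x)
      ...   | yes (y , (k , x≡y^k) , y∉⟨x⟩) = pick (side y Fin.≟ side x)
        where
        y≢x : y ≢ x
        y≢x refl = y∉⟨x⟩ (isPowerOf-refl y)
        y≢e : y ≢ e
        y≢e refl = y∉⟨x⟩ (e-isPowerOf x)
        x≢y⁻¹ : x ≢ inv y
        x≢y⁻¹ x≡y⁻¹ = y≢x (trans (sym (⁻¹-involutive y)) (trans (cong inv (sym x≡y⁻¹)) x⁻¹≡x))
        -- An involution y has only the powers e and y, neither of which is x.
        y⁻¹≢y : inv y ≢ y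
        y⁻¹≢y y⁻¹≡y with pow-involution (trans (cong (y ·_) (sym y⁻¹≡y)) (inverseʳ y)) k
        ... | inj₁ y^k≡e = x≢e (trans x≡y^k y^k≡e)
        ... | inj₂ y^k≡y = y≢x (sym (trans x≡y^k y^k≡y))
        pick : Dec (side y ≡ side x) → ∃ λ x′ → Adj G x x′ × x′ ≢ e × side x′ ≢ side x
        pick (no sides≢)  = y , (y≢x ∘ sym , inj₁ (k , x≡y^k)) , y≢e , sides≢
        pick (yes sides≡) = inv y , (x≢y⁻¹ , inj₁ (isPowerOf-trans (k , x≡y^k) (isPowerOf-inv y)))
                          , inv≢e y≢e , λ eq → side-inv y y⁻¹≢y (trans eq (sym sides≡))

      colour3 : Fin n → Fin n → Fin 3
      colour3 x y with x Fin.≟ e | y Fin.≟ e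
      ... | yes _ | _     = side y
      ... | no _  | yes _ = side x
      ... | no _  | no _  = suc (suc zero)

      colour3-sym : ∀ x y → colour3 x y ≡ colour3 y x
      colour3-sym x y with x Fin.≟ e | y Fin.≟ e
      ... | yes x≡e | yes y≡e = cong side (trans y≡e (sym x≡e))
      ... | yes _   | no _    = refl
      ... | no _    | yes _   = refl
      ... | no _    | no _    = refl

      colour3-eˡ : ∀ y → colour3 e y ≡ side y
      colour3-eˡ y with e Fin.≟ e
      ... | yes _  = refl
      ... | no e≢e = ⊥-elim (e≢e refl)

      colour3-eʳ : ∀ x → colour3 x e ≡ side x
      colour3-eʳ x = trans (colour3-sym x e) (colour3-eˡ x)

      colour3-away : ∀ {x y} → x ≢ e → y ≢ e → colour3 x y ≡ suc (suc zero)
      colour3-away {x} {y} x≢e y≢e with x Fin.≟ e | y Fin.≟ e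
      ... | yes x≡e | _       = ⊥-elim (x≢e x≡e)
      ... | no _    | yes y≡e = ⊥-elim (y≢e y≡e)
      ... | no _    | no _    = refl

      rainbowPath-avoiding-e : ∀ {x y} → x ≢ e → y ≢ e → ∃ λ cs → Path G colour3 x y cs × Unique cs
      rainbowPath-avoiding-e {x} {y} x≢e y≢e with side x Fin.≟ side y
      ... | no sides≢ = _ , step (x~e x≢e) (step (e~y y≢e) (here y))
                      , ((λ eq → sides≢ (trans (sym (colour3-eʳ x)) (trans eq (colour3-eˡ y)))) ∷ []) ∷ [] ∷ []
      ... | yes sides≡ with neighbour-on-other-side x≢e
      ...   | x′ , x~x′ , x′≢e , sides≢ = _ , step x~x′ (step (x~e x′≢e) (step (e~y y≢e) (here y)))
        , ( (λ eq → side≢2 x′ (trans (sym (colour3-eʳ x′)) (trans (sym eq) x→x′)))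
          ∷ (λ eq → side≢2 y (trans (sym (colour3-eˡ y)) (trans (sym eq) x→x′))) ∷ [])
        ∷ ((λ eq → sides≢ (trans (sym (colour3-eʳ x′)) (trans eq (trans (colour3-eˡ y) (sym sides≡))))) ∷ [])
        ∷ [] ∷ []
        where
        x→x′ : colour3 x x′ ≡ suc (suc zero)
        x→x′ = colour3-away x≢e x′≢e

      rainbowColouring-3 : HasRainbowColouring G 3
      rainbowColouring-3 = record { col = colour3 ; sym = colour3-sym } , rainbow
        where
        rainbow : ∀ x y → ∃ λ cs → Path G colour3 x y cs × Unique cs
        rainbow x y with x Fin.≟ y | adjacent? x y
        ... | yes refl | _       = [] , here x , []
        ... | no _     | yes x~y = _ , step x~y (here y) , [] ∷ []
        ... | no x≢y   | no x≁y  =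
          rainbowPath-avoiding-e (nonadjacent⇒≢eˡ x≢y x≁y) (nonadjacent⇒≢eʳ x≢y x≁y)

    rcIs : ∀ {r} → 1 ≤ r → HasRainbowColouring G r →
           (∀ {k} → 1 ≤ k → k ℕ.< r → ¬ HasRainbowColouring G k) → RcIs G r
    rcIs 1≤r rainbow none-fewer =
      1≤r , rainbow , λ k 1≤k rainbow-k → ≮⇒≥ (λ k<r → none-fewer 1≤k k<r rainbow-k)

    rcIs-1 : HasRainbowColouring G 1 → RcIs G 1
    rcIs-1 rainbow = rcIs (s≤s z≤n) rainbow λ { (s≤s _) (s≤s ()) }

    rcIs-2 : ¬ HasRainbowColouring G 1 → HasRainbowColouring G 2 → RcIs G 2
    rcIs-2 ¬rainbow-1 rainbow = rcIs (s≤s z≤n) rainbow λ { (s≤s z≤n) (s≤s (s≤s z≤n)) → ¬rainbow-1 }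

    rcIs-3 : ¬ HasRainbowColouring G 1 → ¬ HasRainbowColouring G 2 → HasRainbowColouring G 3 → RcIs G 3
    rcIs-3 ¬rainbow-1 ¬rainbow-2 rainbow = rcIs (s≤s z≤n) rainbow λ
      { (s≤s z≤n) (s≤s (s≤s z≤n))       → ¬rainbow-1
      ; (s≤s z≤n) (s≤s (s≤s (s≤s z≤n))) → ¬rainbow-2 }

    rcIs-2⊎3 : NoMaximalInvolutions G → ¬ HasRainbowColouring G 1 → RcIs G 2 ⊎ RcIs G 3
    rcIs-2⊎3 no-maximal ¬rainbow-1 with hasRainbowColouring-2?
    ... | yes rainbow-2 = inj₁ (rcIs-2 ¬rainbow-1 rainbow-2)
    ... | no ¬rainbow-2 = inj₂ (rcIs-3 ¬rainbow-1 ¬rainbow-2 (rainbowColouring-3 no-maximal))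

module CyclicGroup (G : FinGroup) (g : Fin (FinGroup.n G)) (generates : ∀ x → IsPowerOf G x g) where

  open PowerGraph
  open MultiplesMod
  open RainbowColouringMod
  open import Data.Nat as ℕ using (ℕ; _*_; _<_; _≤_; z≤n; s≤s; NonZero)
  open import Data.Nat.Properties as ℕ using ()
  open import Data.Nat.DivMod using (_%_; m%n<n)
  open import Data.Fin as Fin using (Fin; toℕ; fromℕ<)
  open import Data.Fin.Properties as Fin using (toℕ-fromℕ<; injective⇒≤; toℕ<n; 2↔Bool)
  open import Function.Bundles using (Inverse)
  open import Data.Product
  open import Data.Sum
  open import Data.Empty
  open import Function using (_∘_)
  open import Relation.Nullary
  open import Relation.Binary.PropositionalEquality

  open FinGroup G
  open GroupPowers G

  instance
    nonZero-n : NonZero n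
    nonZero-n = ℕ.>-nonZero (ℕ.<-≤-trans (s≤s z≤n) (toℕ<n e))

  order≥n : ∀ {d} → 0 < d → pow G g d ≡ e → n ≤ d
  order≥n {d} 0<d g^d≡e = injective⇒≤ {f = residue} injective
    where
    instance
      nonZero-d : NonZero d
      nonZero-d = ℕ.>-nonZero 0<d
    residue : Fin n → Fin d
    residue x = fromℕ< (m%n<n (proj₁ (generates x)) d)
    pow-residue : ∀ x → x ≡ pow G g (toℕ (residue x))
    pow-residue x = trans (proj₂ (generates x)) (trans (pow-% g d g^d≡e (proj₁ (generates x)))
                                                      (cong (pow G g) (sym (toℕ-fromℕ< (m%n<n (proj₁ (generates x)) d)))))
    injective : ∀ {x y} → residue x ≡ residue y → x ≡ y
    injective {x} {y} eq = trans (pow-residue x) (trans (cong (pow G g ∘ toℕ) eq) (sym (pow-residue y)))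

  g^n≡e : pow G g n ≡ e
  g^n≡e with order g
  ... | d , 0<d , d≤n , g^d≡e = subst (λ t → pow G g t ≡ e) (ℕ.≤-antisym d≤n (order≥n 0<d g^d≡e)) g^d≡e

  pow-injective-≤ : ∀ {a b} → a ≤ b → b < n → pow G g a ≡ pow G g b → a ≡ b
  pow-injective-≤ {a} {b} a≤b b<n g^a≡g^b with ℕ.m≤n⇒m<n∨m≡n a≤b
  ... | inj₂ a≡b = a≡b
  ... | inj₁ a<b = ⊥-elim (ℕ.<⇒≱ (ℕ.≤-<-trans (ℕ.m∸n≤m b a) b<n)
                                  (order≥n (ℕ.m<n⇒0<n∸m a<b) (pow-≡⇒pow-∸≡e g a≤b g^a≡g^b)))

  pow-injective : ∀ {a b} → a < n → b < n → pow G g a ≡ pow G g b → a ≡ b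
  pow-injective {a} {b} a<n b<n g^a≡g^b with ℕ.≤-total a b
  ... | inj₁ a≤b = pow-injective-≤ a≤b b<n g^a≡g^b
  ... | inj₂ b≤a = sym (pow-injective-≤ b≤a a<n (sym g^a≡g^b))

  index : Fin n → ℕ
  index x = proj₁ (generates x) % n

  index<n : ∀ x → index x < n
  index<n x = m%n<n (proj₁ (generates x)) n

  pow-index : ∀ x → pow G g (index x) ≡ x
  pow-index x = sym (trans (proj₂ (generates x)) (pow-% g n g^n≡e (proj₁ (generates x))))

  index-pow : ∀ {a} → a < n → index (pow G g a) ≡ a
  index-pow a<n = pow-injective (index<n _) a<n (pow-index _)

  isMultipleMod⇒isPowerOf : ∀ {x y} → IsMultipleMod n (index x) (index y) → IsPowerOf G x y
  isMultipleMod⇒isPowerOf {x} {y} (k , k*iy≡ix) = k , (begin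
    x                          ≡⟨ pow-index x ⟨
    pow G g (index x)          ≡⟨ cong (pow G g) k*iy≡ix ⟨
    pow G g (k * index y % n)  ≡⟨ pow-% g n g^n≡e (k * index y) ⟨
    pow G g (k * index y)      ≡⟨ pow-pow g (index y) k ⟨
    pow G (pow G g (index y)) k ≡⟨ cong (λ t → pow G t k) (pow-index y) ⟩
    pow G y k                  ∎)
    where open ≡-Reasoning

  isPowerOf⇒isMultipleMod : ∀ {a b} → a < n → IsPowerOf G (pow G g a) (pow G g b) → IsMultipleMod n a b
  isPowerOf⇒isMultipleMod {a} {b} a<n (k , g^a≡[g^b]^k) = k , pow-injective (m%n<n (k * b) n) a<n (begin
    pow G g (k * b % n)   ≡⟨ pow-% g n g^n≡e (k * b) ⟨
    pow G g (k * b)       ≡⟨ pow-pow g b k ⟨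
    pow G (pow G g b) k   ≡⟨ g^a≡[g^b]^k ⟨
    pow G g a             ∎)
    where open ≡-Reasoning

  comparableMod⇒comparable : ∀ {x y} → ComparableMod n (index x) (index y) → Comparable G x y
  comparableMod⇒comparable = Data.Sum.map isMultipleMod⇒isPowerOf isMultipleMod⇒isPowerOf

  comparable⇒comparableMod : ∀ {a b} → a < n → b < n → Comparable G (pow G g a) (pow G g b) → ComparableMod n a b
  comparable⇒comparableMod a<n b<n = Data.Sum.map (isPowerOf⇒isMultipleMod a<n) (isPowerOf⇒isMultipleMod b<n)

  primePower⇒comparable : IsPrimePower n → ∀ x y → Comparable G x y
  primePower⇒comparable (p , a , p-prime , n≡p^a) x y =
    comparableMod⇒comparable (primePower⇒comparableMod n p-prime a n≡p^a (index<n x) (index<n y))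

  ¬primePower⇒¬rainbow-1 : ¬ IsPrimePower n → ¬ HasRainbowColouring G 1
  ¬primePower⇒¬rainbow-1 ¬pp rainbow with ¬primePower⇒incomparable n ¬pp
  ... | a , b , a<n , b<n , incomparable =
    incomparable (comparable⇒comparableMod a<n b<n (rainbow-1⇒comparable G rainbow (pow G g a) (pow G g b)))

  rainbowColouring-2 : HasRainbowColouring G 2
  rainbowColouring-2 = ζ , rainbowWithin2⇒rainbow G ζ within2
    where
    open RainbowTwoColouringMod (rainbowTwoColouringMod n)
    open Inverse 2↔Bool using (to; from; strictlyInverseˡ)
    from-injective : ∀ {b b′} → from b ≡ from b′ → b ≡ b′
    from-injective {b} {b′} eq = trans (sym (strictlyInverseˡ b)) (trans (cong to eq) (strictlyInverseˡ b′))
    ζ : EdgeColouring G 2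
    ζ = record { col = λ x y → from (colour (index x) (index y)) ; sym = λ x y → cong from (colour-sym _ _) }
    within2 : RainbowWithin2 G (EdgeColouring.col ζ)
    within2 x y with x Fin.≟ y | adjacent? G x y
    ... | yes x≡y | _       = inj₁ x≡y
    ... | no _    | yes x~y = inj₂ (inj₁ x~y)
    ... | no x≢y  | no x≁y with detour (index<n x) (index<n y) (x≁y ∘ (x≢y ,_) ∘ comparableMod⇒comparable)
    ...   | w , w<n , w≢ix , w≢iy , ix~w , w~iy , colours≢ = inj₂ (inj₂ (z ,
            ((λ x≡z → w≢ix (trans (sym iz≡w) (cong index (sym x≡z)))) , comparableMod⇒comparable x~z) ,
            ((λ z≡y → w≢iy (trans (sym iz≡w) (cong index z≡y))) , comparableMod⇒comparable z~y) ,
            λ eq → colours≢ (from-injective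
                     (subst (λ t → from (colour (index x) t) ≡ from (colour t (index y))) iz≡w eq))))
      where
      z = pow G g w
      iz≡w : index z ≡ w
      iz≡w = index-pow w<n
      x~z : ComparableMod n (index x) (index z)
      x~z = subst (ComparableMod n (index x)) (sym iz≡w) ix~w
      z~y : ComparableMod n (index z) (index y)
      z~y = subst (λ t → ComparableMod n t (index y)) (sym iz≡w) w~iy

open PowerGraph

theorem3p1 : (G : FinGroup) → NoMaximalInvolutions G →
    ((IsCyclic G → (IsPrimePower (FinGroup.n G) → RcIs G 1)
                 × (¬ IsPrimePower (FinGroup.n G) → RcIs G 2))
    × (¬ IsCyclic G → RcIs G 2 ⊎ RcIs G 3))
theorem3p1 G no-maximal =
    (λ (g , generates) → let open CyclicGroup G g generates in
        (λ primePower → rcIs-1 G (comparable⇒rainbow-1 G (primePower⇒comparable primePower)))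
      , (λ ¬primePower → rcIs-2 G (¬primePower⇒¬rainbow-1 ¬primePower) rainbowColouring-2))
  , λ ¬cyclic → rcIs-2⊎3 G no-maximal (¬cyclic⇒¬rainbow-1 G ¬cyclic)
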